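{- Let $\Lambda$ be an alphabet, $\Lambda^*$ the free monoid of all finite words over $\Lambda$ (including the empty word $\varepsilon$), and let $M\subseteq \Lambda^*\setminus\{\varepsilon\}$. Consider the truncation game induced by $M$: its positions are all words in $\Lambda^*$, and a valid move replaces $v_1\cdots v_n$ by $v_1\cdots v_i$ (for some $0\le i<n$) whenever $v_{i+1}\cdots v_n\in M$. Call a nonempty word $v_1\cdots v_n$ an elementary kernel position if $v_1\cdots v_n\notin M$ but $v_1\cdots v_m\in M$ for all $1\le m<n$. Then for $n>1$, starting from an elementary kernel position $v_1\cdots v_n$, the first player is either unable to move, or is able to move only to a position from which the second player can win in a single move.
   Context: Two players alternate moves; a player who cannot move loses (the player who moved into a position with no valid moves wins). "Win in a single move" means moving to a position from which no valid move exists. -}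

module Defs where

open import Data.List using (List; []; _∷_; _++_; length)
open import Data.Nat using (ℕ; _>_)
open import Data.Product using (Σ; ∃; _×_; _,_)
open import Relation.Binary.PropositionalEquality using (_≡_; _≢_)
open import Relation.Nullary using (¬_)

-- Words over the alphabet Λ are lists; the empty word ε is [].
-- A set M ⊆ Λ* \ {ε} is a predicate on words together with ¬ M [].

Move : {Λ : Set} → (List Λ → Set) → List Λ → List Λ → Set
Move M w u = Σ _ λ s → (w ≡ u ++ s) × (s ≢ []) × M s

Terminal : {Λ : Set} → (List Λ → Set) → List Λ → Set
Terminal M w = ∀ u → ¬ Move M w u

WinsInOne : {Λ : Set} → (List Λ → Set) → List Λ → Set
WinsInOne M w = ∃ λ u → Move M w u × Terminal M u

ElementaryKernel : {Λ : Set} → (List Λ → Set) → List Λ → Set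
ElementaryKernel M w =
  (w ≢ []) × ¬ M w ×
  (∀ p s → w ≡ p ++ s → p ≢ [] → s ≢ [] → M p)

module Submission where

-- Two general facts
-- about the game drive the argument:
--   * the empty word ε is terminal (every move removes a nonempty suffix),
--     so any nonempty word lying in M wins in a single move by truncating
--     itself entirely down to ε;
--   * from a word w ∉ M a move can never remove the whole word, so the
--     remaining prefix u is nonempty.
-- For an elementary kernel position w, the prefix u left by any move is
-- therefore a nonempty proper prefix of w, hence lies in M, hence the second
-- player wins in one move.

open import Defs
open import Data.List using (List; []; _∷_; length)
open import Data.Nat using (_>_)
open import Data.Sum using (_⊎_; inj₂)
open import Data.Product using (_,_)
open import Relation.Nullary using (¬_)
open import Relation.Binary.PropositionalEquality using (_≢_; refl)

empty-terminal : {Λ : Set} (M : List Λ → Set) → Terminal M []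
empty-terminal M []      ([]      , refl , s≢[] , _) = s≢[] refl
empty-terminal M []      ((_ ∷ _) , ()   , _    , _)
empty-terminal M (_ ∷ _) (_       , ()   , _    , _)

member-wins-in-one : {Λ : Set} (M : List Λ → Set) (w : List Λ) →
  w ≢ [] → M w → WinsInOne M w
member-wins-in-one M w w≢[] Mw =
  [] , (w , refl , w≢[] , Mw) , empty-terminal M

move-from-nonmember-leaves-nonempty : {Λ : Set} (M : List Λ → Set)
  (w u : List Λ) → ¬ M w → Move M w u → u ≢ []
move-from-nonmember-leaves-nonempty M w .[] ¬Mw (s , refl , _ , Ms) refl =
  ¬Mw Ms

move-from-kernel-lands-in-M : {Λ : Set} (M : List Λ → Set) (w u : List Λ) →
  ElementaryKernel M w → Move M w u → M u
move-from-kernel-lands-in-M M w u (_ , ¬Mw , prefixes-in-M) mv@(s , w≡u++s , s≢[] , _) =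
  prefixes-in-M u s w≡u++s (move-from-nonmember-leaves-nonempty M w u ¬Mw mv) s≢[]

lemma2p7 : {Λ : Set} (M : List Λ → Set) → ¬ M [] →
    (w : List Λ) → length w > 1 → ElementaryKernel M w →
    Terminal M w ⊎ (∀ u → Move M w u → WinsInOne M u)
lemma2p7 M _ w _ kernel@(_ , ¬Mw , _) = inj₂ λ u mv →
  member-wins-in-one M u
    (move-from-nonmember-leaves-nonempty M w u ¬Mw mv)
    (move-from-kernel-lands-in-M M w u kernel mv)
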